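{- Let $P$ be a finite graded poset with $\hat0$ and $\hat1$. The following conditions are equivalent: (a) The flag $h$-vector $\beta_P$ is multiplicity-free. (b) $P$ has at most two elements of each rank.
   Context: For a finite graded poset $P$ of rank $n$ with $\hat0,\hat1$ and rank function $\rho$, the flag $f$-vector is $\alpha_P(S)=$ number of chains $C$ of $P$ with $\{\rho(t):t\in C\}=S$, for $S\subseteq[n-1]$, and the flag $h$-vector is $\beta_P(S)=\sum_{T\subseteq S}(-1)^{\#(S-T)}\alpha_P(T)$. $\beta_P$ is multiplicity-free if $\beta_P(S)\in\{0,1,-1\}$ for all $S\subseteq[n-1]$. -}

module Defs where

open import Data.Bool using (Bool; true; false; T; _∧_; _∨_; not; if_then_else_)
open import Data.Nat using (ℕ; zero; suc; _∸_; _≤_; _≡ᵇ_; _≤ᵇ_)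
open import Data.Fin using (Fin; toℕ)
open import Data.Fin.Subset using (Subset; inside; outside; ∣_∣)
open import Data.Vec using (Vec; []; _∷_; lookup)
open import Data.List using (List; []; _∷_; map; _++_; filterᵇ; length; allFin)
open import Data.Bool.ListAction using (all; any)
open import Data.Integer using (ℤ; +_; -_; _+_; _*_; -1ℤ; 0ℤ; 1ℤ)
open import Data.Product using (_×_)
open import Data.Sum using (_⊎_)
open import Relation.Binary.PropositionalEquality using (_≡_; _≢_)

-- The carrier is Fin size, the order is
-- a Boolean-valued relation (finite, hence decidable), and the rank function
-- ρ satisfies ρ 0̂ = 0, ρ 1̂ = rank, and ρ y = ρ x + 1 whenever y covers x.
-- (This is equivalent to "every maximal chain has length rank", and then ρ is
-- the rank function of P.)
record GradedPoset : Set where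
  field
    size    : ℕ
    _≼_     : Fin size → Fin size → Bool
    ≼-refl  : ∀ x → T (x ≼ x)
    ≼-antisym : ∀ x y → T (x ≼ y) → T (y ≼ x) → x ≡ y
    ≼-trans : ∀ x y z → T (x ≼ y) → T (y ≼ z) → T (x ≼ z)
    bot     : Fin size
    top     : Fin size
    bot-min : ∀ x → T (bot ≼ x)
    top-max : ∀ x → T (x ≼ top)
    rank    : ℕ
    ρ       : Fin size → ℕ
    ρ-bot   : ρ bot ≡ 0
    ρ-top   : ρ top ≡ rank
    ρ-cover : ∀ x y → T (x ≼ y) → x ≢ y →
              (∀ z → T (x ≼ z) → T (z ≼ y) → z ≡ x ⊎ z ≡ y) →
              ρ y ≡ suc (ρ x)

subsets : (k : ℕ) → List (Subset k)
subsets zero    = [] ∷ []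
subsets (suc k) = map (outside ∷_) (subsets k) ++ map (inside ∷_) (subsets k)

_⊆ᵇ_ : ∀ {k} → Subset k → Subset k → Bool
[]      ⊆ᵇ []      = true
(a ∷ s) ⊆ᵇ (b ∷ t) = (not a ∨ b) ∧ (s ⊆ᵇ t)

module _ (P : GradedPoset) where
  open GradedPoset P

  -- A set S ⊆ [rank - 1] = {1, …, rank-1} is encoded as a Subset (rank ∸ 1),
  -- where index i stands for the rank value (toℕ i + 1).
  RankSet : Set
  RankSet = Subset (rank ∸ 1)

  memRank : RankSet → ℕ → Bool
  memRank S r = any (λ i → lookup S i ∧ (suc (toℕ i) ≡ᵇ r)) (allFin (rank ∸ 1))

  isChain : Subset size → Bool
  isChain C = all (λ x → all (λ y →
                not (lookup C x ∧ lookup C y) ∨ (x ≼ y) ∨ (y ≼ x))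
              (allFin size)) (allFin size)

  hasRankSet : Subset size → RankSet → Bool
  hasRankSet C S =
    all (λ x → not (lookup C x) ∨ memRank S (ρ x)) (allFin size) ∧
    all (λ i → not (lookup S i) ∨
               any (λ x → lookup C x ∧ (ρ x ≡ᵇ suc (toℕ i))) (allFin size))
        (allFin (rank ∸ 1))

  flagF : RankSet → ℕ
  flagF S = length (filterᵇ (λ C → isChain C ∧ hasRankSet C S) (subsets size))

  sign : ℕ → ℤ
  sign zero    = 1ℤ
  sign (suc k) = - sign k

  sumℤ : List ℤ → ℤ
  sumℤ []       = 0ℤ
  sumℤ (x ∷ xs) = x + sumℤ xs

  flagH : RankSet → ℤ
  flagH S = sumℤ (map (λ T → sign (∣ S ∣ ∸ ∣ T ∣) * + flagF T)
                      (filterᵇ (λ T → T ⊆ᵇ S) (subsets (rank ∸ 1))))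

  MultiplicityFree : Set
  MultiplicityFree = ∀ (S : RankSet) → flagH S ≡ 0ℤ ⊎ flagH S ≡ 1ℤ ⊎ flagH S ≡ -1ℤ

  rankCount : ℕ → ℕ
  rankCount r = length (filterᵇ (λ x → ρ x ≡ᵇ r) (allFin size))

  AtMostTwoPerRank : Set
  AtMostTwoPerRank = ∀ (r : ℕ) → rankCount r ≤ 2

module Submission where

-- The flag h-vector is a signed chain count: for S ⊆ [n-1], β_P(S) = (-1)^#S χ(P_S), where P_S
-- is the set of elements with rank in S and χ(D) = Σ (-1)^#C over the chains C ⊆ D, the empty
-- chain included.  Splitting off the chains through one element x gives the deletion rule
-- χ(D) = χ(D - x) - χ(link of x in D), and χ vanishes on a cone.
--
-- (a) ⇒ (b): for S = {r}, P_S is an antichain and β_P(S) = #(elements of rank r) - 1.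
-- (b) ⇒ (a): build P_S rank by rank.  The link of a new element x of rank r in the part already
-- built is either all of it (if all of it lies below x) or a cone whose apex is the element of the
-- previous rank of S below x, since that rank has at most two elements.  So adding rank r turns
-- χ = s into (1 - k) s with k ≤ 2, and χ stays in {0, 1, -1}.

open import Data.Bool using (Bool; true; false; T; _∧_; _∨_; not; if_then_else_)
open import Data.Bool.ListAction using (all; any)
open import Data.Bool.Properties using (T-≡; T-∧; T-∨; not-¬; ∨-comm; ∧-zeroʳ)
open import Data.Empty using (⊥-elim)
open import Data.Fin as Fin using (Fin; toℕ; fromℕ<)
open import Data.Fin.Induction using (po-wellFounded; po-noetherian)
open import Data.Fin.Properties using (_≟_; any?; toℕ<n; toℕ-injective; toℕ-fromℕ<)
open import Data.Fin.Subset using (Subset; ∣_∣; ⊥; ⁅_⁆)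
open import Data.Fin.Subset.Properties using (∣⊥∣≡0; ∣⁅x⁆∣≡1; x∈⁅x⁆; x∈⁅y⁆⇒x≡y)
open import Data.Integer using (ℤ; +_; -_; _+_; _*_; _-_; 0ℤ; 1ℤ; -1ℤ)
open import Data.Integer.Properties
  using (-1*i≡-i; *-identityʳ; *-zeroʳ; +-inverseʳ; +-identityˡ; +-identityʳ; +-assoc)
open import Data.Integer.Tactic.RingSolver using (solve-∀)
open import Data.List using (List; []; _∷_; map; _++_; filterᵇ; length; allFin)
open import Data.List.Membership.Propositional using (_∈_; _∉_; lose)
open import Data.List.Membership.Propositional.Properties using (∈-allFin; ∈-filter⁺; ∈-filter⁻)
open import Data.List.Properties using (length-filter)
import Data.List.Relation.Unary.All as All
open import Data.List.Relation.Unary.All using (_∷_)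
open import Data.List.Relation.Unary.All.Properties using (all⁺; all⁻)
open import Data.List.Relation.Unary.AllPairs using (_∷_)
open import Data.List.Relation.Unary.Any using (here; there; satisfied)
open import Data.List.Relation.Unary.Any.Properties using (any⁺; any⁻)
open import Data.List.Relation.Unary.Unique.Propositional using (Unique)
open import Data.List.Relation.Unary.Unique.Propositional.Properties using (filter⁺; allFin⁺)
open import Data.Nat using (ℕ; zero; suc; _≡ᵇ_; _<ᵇ_; _∸_; _≤_; _<_; z≤n; s≤s)
open import Data.Nat.Properties
  using (≤-refl; ≤-trans; ≤-antisym; ≤-pred; <-irrefl; <⇒≤; <⇒≱; ≰⇒>; ≤∧≢⇒<; n≮0; n<1+n; n≤1+n;
         m≤n⇒m≤1+n; ∸-monoˡ-≤; suc-injective; ≡ᵇ⇒≡; ≡⇒≡ᵇ; <ᵇ⇒<; <⇒<ᵇ; _≤?_)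
  renaming (_≟_ to _≟ℕ_)
open import Data.Product using (_×_; _,_; proj₁; proj₂; ∃-syntax)
open import Data.Sum using (_⊎_; inj₁; inj₂; [_,_]′)
open import Data.Unit using (tt)
open import Data.Vec using ([]; _∷_; head; lookup; tabulate; _[_]≔_)
open import Data.Vec.Properties
  using (lookup⇒[]=; []=⇒lookup; lookup-replicate; lookup∘tabulate; tabulate∘lookup; tabulate-cong;
         lookup∘update; lookup∘update′)
open import Function using (_∘_; flip)
open import Function.Bundles using (_⇔_; mk⇔; Equivalence)
open import Induction.WellFounded using (WellFounded; Acc; acc)
open import Relation.Binary.PropositionalEquality
open import Relation.Binary.Structures using (IsPartialOrder)
open import Relation.Nullary using (¬_; Dec; yes; no; ¬?; _×-dec_)
open import Relation.Nullary.Decidable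
  using (T?; ⌊_⌋; decidable-stable; toWitness; fromWitness; toWitnessFalse; fromWitnessFalse)

open import Defs

T-∧⁺ : ∀ {a b} → T a → T b → T (a ∧ b)
T-∧⁺ p q = Equivalence.from T-∧ (p , q)

T-∧⁻ : ∀ {a b} → T (a ∧ b) → T a × T b
T-∧⁻ {a} {b} = Equivalence.to (T-∧ {a} {b})

T-∨⁺ˡ : ∀ {a b} → T a → T (a ∨ b)
T-∨⁺ˡ p = Equivalence.from T-∨ (inj₁ p)

T-∨⁺ʳ : ∀ {a b} → T b → T (a ∨ b)
T-∨⁺ʳ {a} q = Equivalence.from (T-∨ {a}) (inj₂ q)

T-∨⁻ : ∀ {a b} → T (a ∨ b) → T a ⊎ T b
T-∨⁻ {a} {b} = Equivalence.to (T-∨ {a} {b})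

-- Defs encodes an implication a ⇒ b as not a ∨ b.
T-⇒⁺ : ∀ {a b} → (T a → T b) → T (not a ∨ b)
T-⇒⁺ {true}  f = f tt
T-⇒⁺ {false} _ = tt

T-⇒⁻ : ∀ {a b} → T (not a ∨ b) → T a → T b
T-⇒⁻ {true} q _ = q

T-⇔→≡ : ∀ {a b} → (T a → T b) → (T b → T a) → a ≡ b
T-⇔→≡ {false} {false} _ _ = refl
T-⇔→≡ {false} {true}  _ g = ⊥-elim (g tt)
T-⇔→≡ {true}  {false} f _ = ⊥-elim (f tt)
T-⇔→≡ {true}  {true}  _ _ = refl

T-true : ∀ {a} → T a → a ≡ true
T-true = Equivalence.to T-≡

T-false : ∀ {a} → ¬ T a → a ≡ false
T-false {false} _  = refl
T-false {true}  ¬a = ⊥-elim (¬a tt)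

all-allFin⁻ : ∀ {n} (f : Fin n → Bool) → T (all f (allFin n)) → ∀ i → T (f i)
all-allFin⁻ f h i = All.lookup (all⁺ f (allFin _) h) (∈-allFin i)

all-allFin⁺ : ∀ {n} (f : Fin n → Bool) → (∀ i → T (f i)) → T (all f (allFin n))
all-allFin⁺ {n} f h = all⁻ f {xs = allFin n} (All.tabulate (λ {i} _ → h i))

any-allFin⁻ : ∀ {n} (f : Fin n → Bool) → T (any f (allFin n)) → ∃[ i ] T (f i)
any-allFin⁻ f h = satisfied (any⁻ f (allFin _) h)

any-allFin⁺ : ∀ {n} (f : Fin n → Bool) i → T (f i) → T (any f (allFin n))
any-allFin⁺ f i fi = any⁺ f (lose (∈-allFin i) fi)

⟦_⟧·_ : Bool → ℤ → ℤ
⟦ b ⟧· z = if b then z else 0ℤ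

private variable
  A B : Set

∑ : List A → (A → ℤ) → ℤ
∑ []       f = 0ℤ
∑ (x ∷ xs) f = f x + ∑ xs f

syntax ∑ xs (λ x → e) = ∑[ x ∈ xs ] e

∑-cong : ∀ (xs : List A) {f g : A → ℤ} → (∀ x → f x ≡ g x) → ∑ xs f ≡ ∑ xs g
∑-cong []       _ = refl
∑-cong (x ∷ xs) e = cong₂ _+_ (e x) (∑-cong xs e)

∑-zero : ∀ (xs : List A) {f : A → ℤ} → (∀ x → f x ≡ 0ℤ) → ∑ xs f ≡ 0ℤ
∑-zero []       _ = refl
∑-zero (x ∷ xs) e = cong₂ _+_ (e x) (∑-zero xs e)

∑-++ : ∀ (xs ys : List A) (f : A → ℤ) → ∑ (xs ++ ys) f ≡ ∑ xs f + ∑ ys f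
∑-++ []       ys f = sym (+-identityˡ _)
∑-++ (x ∷ xs) ys f rewrite ∑-++ xs ys f = sym (+-assoc (f x) _ _)

∑-map : ∀ (xs : List B) (g : B → A) (f : A → ℤ) → ∑ (map g xs) f ≡ ∑[ x ∈ xs ] f (g x)
∑-map []       g f = refl
∑-map (x ∷ xs) g f = cong (_+_ (f (g x))) (∑-map xs g f)

∑-+ : ∀ (xs : List A) (f g : A → ℤ) → ∑[ x ∈ xs ] (f x + g x) ≡ ∑ xs f + ∑ xs g
∑-+ []       f g = refl
∑-+ (x ∷ xs) f g rewrite ∑-+ xs f g = lemma (f x) (g x) (∑ xs f) (∑ xs g)
  where
  lemma : ∀ a b c d → a + b + (c + d) ≡ a + c + (b + d)
  lemma = solve-∀

∑-difference : ∀ (xs : List A) (f g : A → ℤ) → ∑[ x ∈ xs ] (f x - g x) ≡ ∑ xs f - ∑ xs g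
∑-difference []       f g = refl
∑-difference (x ∷ xs) f g rewrite ∑-difference xs f g = lemma (f x) (g x) (∑ xs f) (∑ xs g)
  where
  lemma : ∀ a b c d → a - b + (c - d) ≡ a + c - (b + d)
  lemma = solve-∀

*-distribˡ-∑ : ∀ (xs : List A) (c : ℤ) (f : A → ℤ) → c * ∑ xs f ≡ ∑[ x ∈ xs ] (c * f x)
*-distribˡ-∑ []       c f = *-zeroʳ c
*-distribˡ-∑ (x ∷ xs) c f rewrite sym (*-distribˡ-∑ xs c f) = lemma c (f x) (∑ xs f)
  where
  lemma : ∀ c a b → c * (a + b) ≡ c * a + c * b
  lemma = solve-∀

∑-comm : ∀ (xs : List A) (ys : List B) (f : A → B → ℤ) →
         ∑[ x ∈ xs ] ∑[ y ∈ ys ] f x y ≡ ∑[ y ∈ ys ] ∑[ x ∈ xs ] f x y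
∑-comm []       ys f = sym (∑-zero ys (λ _ → refl))
∑-comm (x ∷ xs) ys f rewrite ∑-comm xs ys f = sym (∑-+ ys (f x) _)

∑-filterᵇ : ∀ (p : A → Bool) (xs : List A) (f : A → ℤ) →
            ∑ (filterᵇ p xs) f ≡ ∑[ x ∈ xs ] ⟦ p x ⟧· f x
∑-filterᵇ p []       f = refl
∑-filterᵇ p (x ∷ xs) f with p x
... | true  = cong (_+_ (f x)) (∑-filterᵇ p xs f)
... | false = trans (∑-filterᵇ p xs f) (sym (+-identityˡ _))

∑-1≡length : ∀ (xs : List A) → ∑[ x ∈ xs ] 1ℤ ≡ + length xs
∑-1≡length []       = refl
∑-1≡length (x ∷ xs) rewrite ∑-1≡length xs = refl

length-filterᵇ : ∀ (p : A → Bool) (xs : List A) → + length (filterᵇ p xs) ≡ ∑[ x ∈ xs ] ⟦ p x ⟧· 1ℤ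
length-filterᵇ p xs = trans (sym (∑-1≡length (filterᵇ p xs))) (∑-filterᵇ p xs (λ _ → 1ℤ))

⟦⟧·-length-filterᵇ : ∀ (a : Bool) (s : ℤ) (q : A → Bool) (xs : List A) →
                     ⟦ a ⟧· (s * + length (filterᵇ q xs)) ≡ ∑[ x ∈ xs ] ⟦ a ∧ q x ⟧· s
⟦⟧·-length-filterᵇ false s q xs = sym (∑-zero xs (λ _ → refl))
⟦⟧·-length-filterᵇ true  s q xs = begin
  s * + length (filterᵇ q xs)       ≡⟨ cong (s *_) (length-filterᵇ q xs) ⟩
  s * ∑[ x ∈ xs ] ⟦ q x ⟧· 1ℤ        ≡⟨ *-distribˡ-∑ xs s _ ⟩
  ∑[ x ∈ xs ] (s * ⟦ q x ⟧· 1ℤ)      ≡⟨ ∑-cong xs (λ x → *-⟦⟧·1 (q x)) ⟩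
  ∑[ x ∈ xs ] ⟦ q x ⟧· s             ∎
  where
  open ≡-Reasoning
  *-⟦⟧·1 : ∀ b → s * ⟦ b ⟧· 1ℤ ≡ ⟦ b ⟧· s
  *-⟦⟧·1 true  = *-identityʳ s
  *-⟦⟧·1 false = *-zeroʳ s

⟦⟧-neg : ∀ {b b′ w w′} → b′ ≡ b → (T b → w′ ≡ - w) → ⟦ b′ ⟧· w′ ≡ - ⟦ b ⟧· w
⟦⟧-neg {true}  refl w′≡-w = w′≡-w tt
⟦⟧-neg {false} refl _     = refl

∑-choices : ∀ {s : ℤ} (f : A → ℤ) (xs : List A) → (∀ {x} → x ∈ xs → f x ≡ s ⊎ f x ≡ 0ℤ) →
            ∃[ k ] k ≤ length xs × ∑ xs f ≡ + k * s
∑-choices {s = s} f [] _ = 0 , z≤n , refl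
∑-choices {s = s} f (x ∷ xs) choice with ∑-choices f xs (choice ∘ there) | choice (here refl)
... | k , k≤ , ∑≡ | inj₁ fx≡s = suc k , s≤s k≤ , trans (cong₂ _+_ fx≡s ∑≡) (sym (suc-* (+ k) s))
  where
  suc-* : ∀ a b → (1ℤ + a) * b ≡ b + a * b
  suc-* = solve-∀
... | k , k≤ , ∑≡ | inj₂ fx≡0 = k , m≤n⇒m≤1+n k≤ , trans (cong₂ _+_ fx≡0 ∑≡) (+-identityˡ _)

Subset-ext : ∀ {n} {p q : Subset n} → (∀ i → lookup p i ≡ lookup q i) → p ≡ q
Subset-ext {p = p} {q} p≗q = begin
  p                   ≡⟨ sym (tabulate∘lookup p) ⟩
  tabulate (lookup p) ≡⟨ tabulate-cong p≗q ⟩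
  tabulate (lookup q) ≡⟨ tabulate∘lookup q ⟩
  q                   ∎
  where open ≡-Reasoning

module _ {n} {C : Subset n} {x : Fin n} where

  ∈-insert-self : T (lookup (C [ x ]≔ true) x)
  ∈-insert-self = subst T (sym (lookup∘update x C true)) tt

  ∈-insert⁺ : ∀ {y} → T (lookup C y) → T (lookup (C [ x ]≔ true) y)
  ∈-insert⁺ {y} y∈C with y ≟ x
  ... | yes refl = ∈-insert-self
  ... | no y≢x   = subst T (sym (lookup∘update′ y≢x C true)) y∈C

  ∈-insert⁻ : ∀ {y} → T (lookup (C [ x ]≔ true) y) → y ≡ x ⊎ T (lookup C y)
  ∈-insert⁻ {y} y∈C′ with y ≟ x
  ... | yes y≡x = inj₁ y≡x
  ... | no y≢x  = inj₂ (subst T (lookup∘update′ y≢x C true) y∈C′)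

∣insert∣ : ∀ {n} (C : Subset n) x → lookup C x ≡ false → ∣ C [ x ]≔ true ∣ ≡ suc ∣ C ∣
∣insert∣ (false ∷ C) Fin.zero    _ = refl
∣insert∣ (false ∷ C) (Fin.suc x) e = ∣insert∣ C x e
∣insert∣ (true ∷ C)  (Fin.suc x) e = cong suc (∣insert∣ C x e)

⊆ᵇ⁻ : ∀ {k} {U V : Subset k} → T (U ⊆ᵇ V) → ∀ i → T (lookup U i) → T (lookup V i)
⊆ᵇ⁻ {U = a ∷ U} {b ∷ V} h Fin.zero    a∈ = T-⇒⁻ {a} (proj₁ (T-∧⁻ {not a ∨ b} h)) a∈
⊆ᵇ⁻ {U = a ∷ U} {b ∷ V} h (Fin.suc i) i∈ = ⊆ᵇ⁻ {U = U} {V} (proj₂ (T-∧⁻ {not a ∨ b} h)) i i∈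

⊆ᵇ⁺ : ∀ {k} {U V : Subset k} → (∀ i → T (lookup U i) → T (lookup V i)) → T (U ⊆ᵇ V)
⊆ᵇ⁺ {U = []}    {[]}    _   = tt
⊆ᵇ⁺ {U = a ∷ U} {b ∷ V} U⊆V = T-∧⁺ (T-⇒⁺ (U⊆V Fin.zero)) (⊆ᵇ⁺ {U = U} {V} (U⊆V ∘ Fin.suc))

∣∣-mono-⊆ᵇ : ∀ {k} (U V : Subset k) → T (U ⊆ᵇ V) → ∣ U ∣ ≤ ∣ V ∣
∣∣-mono-⊆ᵇ []          []          _ = z≤n
∣∣-mono-⊆ᵇ (true ∷ U)  (true ∷ V)  h = s≤s (∣∣-mono-⊆ᵇ U V h)
∣∣-mono-⊆ᵇ (false ∷ U) (true ∷ V)  h = m≤n⇒m≤1+n (∣∣-mono-⊆ᵇ U V h)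
∣∣-mono-⊆ᵇ (false ∷ U) (false ∷ V) h = ∣∣-mono-⊆ᵇ U V h

⁅⁆⁻ : ∀ {n} {i j : Fin n} → T (lookup ⁅ j ⁆ i) → i ≡ j
⁅⁆⁻ {i = i} {j} i∈ = x∈⁅y⁆⇒x≡y j (lookup⇒[]= i ⁅ j ⁆ (T-true i∈))

⁅⁆-self : ∀ {n} (j : Fin n) → T (lookup ⁅ j ⁆ j)
⁅⁆-self j = subst T (sym ([]=⇒lookup (x∈⁅x⁆ j))) tt

∑-subsets-suc : ∀ n (f : Subset (suc n) → ℤ) →
                ∑ (subsets (suc n)) f ≡ ∑[ C ∈ subsets n ] (f (false ∷ C) + f (true ∷ C))
∑-subsets-suc n f = begin
  ∑ (map (false ∷_) (subsets n) ++ map (true ∷_) (subsets n)) f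
    ≡⟨ ∑-++ (map (false ∷_) (subsets n)) _ f ⟩
  ∑ (map (false ∷_) (subsets n)) f + ∑ (map (true ∷_) (subsets n)) f
    ≡⟨ cong₂ _+_ (∑-map (subsets n) (false ∷_) f) (∑-map (subsets n) (true ∷_) f) ⟩
  ∑[ C ∈ subsets n ] f (false ∷ C) + ∑[ C ∈ subsets n ] f (true ∷ C)
    ≡⟨ sym (∑-+ (subsets n) _ _) ⟩
  ∑[ C ∈ subsets n ] (f (false ∷ C) + f (true ∷ C)) ∎
  where open ≡-Reasoning

∑-subsets-pairing : ∀ n (x : Fin n) (f : Subset n → ℤ) →
                    ∑ (subsets n) f ≡ ∑[ C ∈ subsets n ] (if lookup C x then 0ℤ else f C + f (C [ x ]≔ true))
∑-subsets-pairing (suc n) Fin.zero f = begin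
  ∑ (subsets (suc n)) f
    ≡⟨ ∑-subsets-suc n f ⟩
  ∑[ C ∈ subsets n ] (f (false ∷ C) + f (true ∷ C))
    ≡⟨ ∑-cong (subsets n) (λ _ → sym (+-identityʳ _)) ⟩
  ∑[ C ∈ subsets n ] (f (false ∷ C) + f (true ∷ C) + 0ℤ)
    ≡⟨ sym (∑-subsets-suc n _) ⟩
  ∑[ C ∈ subsets (suc n) ] (if lookup C Fin.zero then 0ℤ else f C + f (C [ Fin.zero ]≔ true)) ∎
  where open ≡-Reasoning
∑-subsets-pairing (suc n) (Fin.suc x) f = begin
  ∑ (subsets (suc n)) f
    ≡⟨ ∑-subsets-suc n f ⟩
  ∑[ C ∈ subsets n ] (f (false ∷ C) + f (true ∷ C))
    ≡⟨ ∑-+ (subsets n) _ _ ⟩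
  ∑[ C ∈ subsets n ] f (false ∷ C) + ∑[ C ∈ subsets n ] f (true ∷ C)
    ≡⟨ cong₂ _+_ (∑-subsets-pairing n x _) (∑-subsets-pairing n x _) ⟩
  ∑[ C ∈ subsets n ] g (false ∷ C) + ∑[ C ∈ subsets n ] g (true ∷ C)
    ≡⟨ sym (∑-+ (subsets n) _ _) ⟩
  ∑[ C ∈ subsets n ] (g (false ∷ C) + g (true ∷ C))
    ≡⟨ sym (∑-subsets-suc n g) ⟩
  ∑ (subsets (suc n)) g ∎
  where
  open ≡-Reasoning
  g : Subset (suc n) → ℤ
  g C = if lookup C (Fin.suc x) then 0ℤ else f C + f (C [ Fin.suc x ]≔ true)

+-collapse : ∀ (h : Bool → ℤ) b → h (not b) ≡ 0ℤ → h false + h true ≡ h b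
+-collapse h false z = trans (cong (_+_ (h false)) z) (+-identityʳ _)
+-collapse h true  z = trans (cong (λ t → t + h true) z) (+-identityˡ _)

∑-subsets-unique : ∀ n (q : Subset n → Bool) (U : Subset n) (g : Subset n → ℤ) →
                   (∀ C → T (q C) → C ≡ U) → T (q U) →
                   ∑[ C ∈ subsets n ] ⟦ q C ⟧· g C ≡ g U
∑-subsets-unique zero q [] g _ qU rewrite T-true qU = +-identityʳ _
∑-subsets-unique (suc n) q (b ∷ U) g unique qU = begin
  ∑[ C ∈ subsets (suc n) ] ⟦ q C ⟧· g C
    ≡⟨ ∑-subsets-suc n _ ⟩
  ∑[ C ∈ subsets n ] (h false C + h true C)
    ≡⟨ ∑-cong (subsets n) (λ C → +-collapse (λ c → h c C) b (vanishes (not b) C (λ e → not-¬ refl (sym e)))) ⟩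
  ∑[ C ∈ subsets n ] h b C
    ≡⟨ ∑-subsets-unique n (λ C → q (b ∷ C)) U (λ C → g (b ∷ C)) (λ C qC → tail-≡ (unique _ qC)) qU ⟩
  g (b ∷ U) ∎
  where
  open ≡-Reasoning
  h : Bool → Subset n → ℤ
  h c C = ⟦ q (c ∷ C) ⟧· g (c ∷ C)
  tail-≡ : ∀ {c C} → c ∷ C ≡ b ∷ U → C ≡ U
  tail-≡ refl = refl
  vanishes : ∀ c C → c ≢ b → h c C ≡ 0ℤ
  vanishes c C c≢b with q (c ∷ C) in qC
  ... | true  = ⊥-elim (c≢b (cong head (unique _ (subst T (sym qC) tt))))
  ... | false = refl

∈-pair : ∀ {a u v : A} → a ∈ u ∷ v ∷ [] → a ≡ u ⊎ a ≡ v
∈-pair (here e)         = inj₁ e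
∈-pair (there (here e)) = inj₂ e

pigeonhole-2 : ∀ {a b c u v : A} → a ≡ u ⊎ a ≡ v → b ≡ u ⊎ b ≡ v → c ≡ u ⊎ c ≡ v →
               a ≡ b ⊎ a ≡ c ⊎ b ≡ c
pigeonhole-2 (inj₁ refl) (inj₁ refl) _           = inj₁ refl
pigeonhole-2 (inj₂ refl) (inj₂ refl) _           = inj₁ refl
pigeonhole-2 (inj₁ refl) (inj₂ refl) (inj₁ refl) = inj₂ (inj₁ refl)
pigeonhole-2 (inj₁ refl) (inj₂ refl) (inj₂ refl) = inj₂ (inj₂ refl)
pigeonhole-2 (inj₂ refl) (inj₁ refl) (inj₁ refl) = inj₂ (inj₂ refl)
pigeonhole-2 (inj₂ refl) (inj₁ refl) (inj₂ refl) = inj₂ (inj₁ refl)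

pigeonhole-length≤2 : ∀ {xs : List A} {a b c} → length xs ≤ 2 → a ∈ xs → b ∈ xs → c ∈ xs →
                      a ≡ b ⊎ a ≡ c ⊎ b ≡ c
pigeonhole-length≤2 {xs = _ ∷ []}     _ (here refl) (here refl) _ = inj₁ refl
pigeonhole-length≤2 {xs = _ ∷ _ ∷ []} _ a∈ b∈ c∈ = pigeonhole-2 (∈-pair a∈) (∈-pair b∈) (∈-pair c∈)
pigeonhole-length≤2 {xs = _ ∷ _ ∷ _ ∷ _} (s≤s (s≤s ()))

Unique-constant⇒length≤1 : ∀ {xs : List A} {z} → Unique xs → (∀ {a} → a ∈ xs → a ≡ z) → length xs ≤ 1
Unique-constant⇒length≤1 {xs = []}         _ _ = z≤n
Unique-constant⇒length≤1 {xs = _ ∷ []}     _ _ = s≤s z≤n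
Unique-constant⇒length≤1 {xs = _ ∷ _ ∷ _} ((x≢y ∷ _) ∷ _) ≡z =
  ⊥-elim (x≢y (trans (≡z (here refl)) (sym (≡z (there (here refl))))))

greatest-below : ∀ (Q : ℕ → Bool) {k r} → k < r → T (Q k) →
                 ∃[ k′ ] k′ < r × T (Q k′) × (∀ {j} → j < r → T (Q j) → j ≤ k′)
greatest-below Q {k} {suc r} k<1+r Qk with Q r in Qr
... | true  = r , n<1+n r , subst T (sym Qr) tt , λ j<1+r _ → ≤-pred j<1+r
... | false =
  let (k′ , k′<r , Qk′ , greatest) = greatest-below Q (below-r k<1+r Qk) Qk
  in k′ , m≤n⇒m≤1+n k′<r , Qk′ , λ j<1+r Qj → greatest (below-r j<1+r Qj) Qj
  where
  below-r : ∀ {j} → j < suc r → T (Q j) → j < r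
  below-r j<1+r Qj = ≤∧≢⇒< (≤-pred j<1+r) (λ { refl → subst T Qr Qj })

<∸1⇒suc< : ∀ {a} n → a < n ∸ 1 → suc a < n
<∸1⇒suc< (suc n) a<n = s≤s a<n

ZeroOrUnit : ℤ → Set
ZeroOrUnit z = z ≡ 0ℤ ⊎ z ≡ 1ℤ ⊎ z ≡ -1ℤ

ZeroOrUnit-* : ∀ {a b} → ZeroOrUnit a → ZeroOrUnit b → ZeroOrUnit (a * b)
ZeroOrUnit-* (inj₁ refl)        _                  = inj₁ refl
ZeroOrUnit-* (inj₂ (inj₁ refl)) (inj₁ refl)        = inj₁ refl
ZeroOrUnit-* (inj₂ (inj₁ refl)) (inj₂ (inj₁ refl)) = inj₂ (inj₁ refl)
ZeroOrUnit-* (inj₂ (inj₁ refl)) (inj₂ (inj₂ refl)) = inj₂ (inj₂ refl)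
ZeroOrUnit-* (inj₂ (inj₂ refl)) (inj₁ refl)        = inj₁ refl
ZeroOrUnit-* (inj₂ (inj₂ refl)) (inj₂ (inj₁ refl)) = inj₂ (inj₂ refl)
ZeroOrUnit-* (inj₂ (inj₂ refl)) (inj₂ (inj₂ refl)) = inj₂ (inj₁ refl)

ZeroOrUnit-1-k : ∀ k → k ≤ 2 → ZeroOrUnit (1ℤ - + k)
ZeroOrUnit-1-k 0 _ = inj₂ (inj₁ refl)
ZeroOrUnit-1-k 1 _ = inj₁ refl
ZeroOrUnit-1-k 2 _ = inj₂ (inj₂ refl)
ZeroOrUnit-1-k (suc (suc (suc _))) (s≤s (s≤s ()))

ZeroOrUnit-1-n⇒n≤2 : ∀ n → ZeroOrUnit (- (1ℤ - + n)) → n ≤ 2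
ZeroOrUnit-1-n⇒n≤2 0 _ = z≤n
ZeroOrUnit-1-n⇒n≤2 1 _ = s≤s z≤n
ZeroOrUnit-1-n⇒n≤2 2 _ = s≤s (s≤s z≤n)
ZeroOrUnit-1-n⇒n≤2 (suc (suc (suc _))) (inj₁ ())
ZeroOrUnit-1-n⇒n≤2 (suc (suc (suc _))) (inj₂ (inj₁ ()))
ZeroOrUnit-1-n⇒n≤2 (suc (suc (suc _))) (inj₂ (inj₂ ()))

module _ (P : GradedPoset) where
  open GradedPoset P

  _≤ₚ_ _<ₚ_ _⋖_ : Fin size → Fin size → Set
  x ≤ₚ y = T (x ≼ y)
  x <ₚ y = x ≤ₚ y × x ≢ y
  x ⋖ y = x <ₚ y × (∀ z → x ≤ₚ z → z ≤ₚ y → z ≡ x ⊎ z ≡ y)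

  ≤ₚ-isPartialOrder : IsPartialOrder _≡_ _≤ₚ_
  ≤ₚ-isPartialOrder = record
    { isPreorder = record
      { isEquivalence = isEquivalence
      ; reflexive     = λ { {x} refl → ≼-refl x }
      ; trans         = λ {x} {y} {z} → ≼-trans x y z
      }
    ; antisym = λ {x} {y} → ≼-antisym x y
    }

  <ₚ-wellFounded : WellFounded _<ₚ_
  <ₚ-wellFounded = po-wellFounded ≤ₚ-isPartialOrder

  >ₚ-wellFounded : WellFounded (flip _<ₚ_)
  >ₚ-wellFounded = po-noetherian ≤ₚ-isPartialOrder

  _<ₚ?_ : ∀ x y → Dec (x <ₚ y)
  x <ₚ? y = T? (x ≼ y) ×-dec ¬? (x ≟ y)

  ρ-⋖ : ∀ {x y} → x ⋖ y → ρ y ≡ suc (ρ x)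
  ρ-⋖ {x} {y} ((x≤y , x≢y) , squeezed) = ρ-cover x y x≤y x≢y squeezed

  cover-below : ∀ {y x} → y <ₚ x → ∃[ z ] y ≤ₚ z × z ⋖ x
  cover-below {y} {x} = go y (>ₚ-wellFounded y)
    where
    go : ∀ y → Acc (flip _<ₚ_) y → y <ₚ x → ∃[ z ] y ≤ₚ z × z ⋖ x
    go y (acc rs) y<x with any? (λ w → (y <ₚ? w) ×-dec (w <ₚ? x))
    ... | yes (w , y<w , w<x) =
      let (z , w≤z , z⋖x) = go w (rs y<w) w<x in z , ≼-trans y w z (proj₁ y<w) w≤z , z⋖x
    ... | no ∄w = y , ≼-refl y , y<x , squeezed
      where
      squeezed : ∀ z → y ≤ₚ z → z ≤ₚ x → z ≡ y ⊎ z ≡ x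
      squeezed z y≤z z≤x with z ≟ y | z ≟ x
      ... | yes z≡y | _         = inj₁ z≡y
      ... | no _    | yes z≡x   = inj₂ z≡x
      ... | no z≢y  | no z≢x    = ⊥-elim (∄w (z , (y≤z , z≢y ∘ sym) , (z≤x , z≢x)))

  ρ-mono : ∀ {y x} → y ≤ₚ x → ρ y ≤ ρ x
  ρ-mono {y} {x} = go x (<ₚ-wellFounded x)
    where
    go : ∀ x → Acc _<ₚ_ x → y ≤ₚ x → ρ y ≤ ρ x
    go x (acc rs) y≤x with y ≟ x
    ... | yes refl = ≤-refl
    ... | no y≢x with cover-below (y≤x , y≢x)
    ... | z , y≤z , z⋖x rewrite ρ-⋖ z⋖x = m≤n⇒m≤1+n (go z (rs (proj₁ z⋖x)) y≤z)

  ρ-strictMono : ∀ {y x} → y <ₚ x → ρ y < ρ x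
  ρ-strictMono y<x with cover-below y<x
  ... | z , y≤z , z⋖x rewrite ρ-⋖ z⋖x = s≤s (ρ-mono y≤z)

  ρ-injective-≤ₚ : ∀ {y x} → y ≤ₚ x → ρ y ≡ ρ x → y ≡ x
  ρ-injective-≤ₚ {y} {x} y≤x ρy≡ρx with y ≟ x
  ... | yes y≡x = y≡x
  ... | no y≢x  = ⊥-elim (<-irrefl ρy≡ρx (ρ-strictMono (y≤x , y≢x)))

  intermediate : ∀ {y x k} → y ≤ₚ x → ρ y ≤ k → k ≤ ρ x → ∃[ z ] ρ z ≡ k × y ≤ₚ z × z ≤ₚ x
  intermediate {y} {x} {k} y≤x ρy≤k = go x (<ₚ-wellFounded x) y≤x
    where
    go : ∀ x → Acc _<ₚ_ x → y ≤ₚ x → k ≤ ρ x → ∃[ z ] ρ z ≡ k × y ≤ₚ z × z ≤ₚ x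
    go x (acc rs) y≤x k≤ρx with k ≟ℕ ρ x
    ... | yes k≡ρx = x , sym k≡ρx , y≤x , ≼-refl x
    ... | no k≢ρx with y ≟ x
    ... | yes refl = ⊥-elim (k≢ρx (≤-antisym k≤ρx ρy≤k))
    ... | no y≢x with cover-below (y≤x , y≢x)
    ... | z , y≤z , z⋖x =
      let k≤ρz = ≤-pred (subst (k <_) (ρ-⋖ z⋖x) (≤∧≢⇒< k≤ρx k≢ρx))
          (w , ρw≡k , y≤w , w≤z) = go z (rs (proj₁ z⋖x)) y≤z k≤ρz
      in w , ρw≡k , y≤w , ≼-trans w z x w≤z (proj₁ (proj₁ z⋖x))

  ρ≤rank : ∀ x → ρ x ≤ rank
  ρ≤rank x = subst (ρ x ≤_) ρ-top (ρ-mono (top-max x))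

  ρ≡0⇒≡bot : ∀ {x} → ρ x ≡ 0 → x ≡ bot
  ρ≡0⇒≡bot {x} ρx≡0 = sym (ρ-injective-≤ₚ (bot-min x) (trans ρ-bot (sym ρx≡0)))

  rank≤ρ⇒≡top : ∀ {x} → rank ≤ ρ x → x ≡ top
  rank≤ρ⇒≡top {x} rank≤ρx = ρ-injective-≤ₚ (top-max x) (trans (≤-antisym (ρ≤rank x) rank≤ρx) (sym ρ-top))

  open import Data.List.Membership.DecPropositional (_≟_ {size}) using (_∈?_)

  Predᵇ : Set
  Predᵇ = Fin size → Bool

  _∈ₛ_ : Fin size → Subset size → Set
  y ∈ₛ C = T (lookup C y)

  _⊑_ : Subset size → Predᵇ → Bool
  C ⊑ D = all (λ y → not (lookup C y) ∨ D y) (allFin size)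

  IsChain : Subset size → Set
  IsChain C = ∀ a b → a ∈ₛ C → b ∈ₛ C → T ((a ≼ b) ∨ (b ≼ a))

  chainIn⁺ : ∀ {C D} → (∀ y → y ∈ₛ C → T (D y)) → IsChain C → T (isChain P C ∧ C ⊑ D)
  chainIn⁺ {C} {D} C⊆D chain = T-∧⁺
    (all-allFin⁺ _ (λ a → all-allFin⁺ _ (λ b → T-⇒⁺ (λ ab∈C →
      let (a∈C , b∈C) = T-∧⁻ ab∈C in chain a b a∈C b∈C))))
    (all-allFin⁺ _ (λ y → T-⇒⁺ (C⊆D y)))

  chainIn⁻ : ∀ {C D} → T (isChain P C ∧ C ⊑ D) → (∀ y → y ∈ₛ C → T (D y)) × IsChain C
  chainIn⁻ {C} {D} h =
    let (chain , C⊑D) = T-∧⁻ {isChain P C} h in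
    (λ y → T-⇒⁻ (all-allFin⁻ _ C⊑D y)) ,
    (λ a b a∈C b∈C → T-⇒⁻ (all-allFin⁻ _ (all-allFin⁻ _ chain a) b) (T-∧⁺ a∈C b∈C))

  hasRank : Subset size → Fin (rank ∸ 1) → Bool
  hasRank C i = any (λ y → lookup C y ∧ (ρ y ≡ᵇ suc (toℕ i))) (allFin size)

  rankSet : Subset size → RankSet P
  rankSet C = tabulate (hasRank C)

  rankSet⁻ : ∀ {C i} → T (lookup (rankSet C) i) → ∃[ y ] y ∈ₛ C × ρ y ≡ suc (toℕ i)
  rankSet⁻ {C} {i} i∈ rewrite lookup∘tabulate (hasRank C) i =
    let (y , h) = any-allFin⁻ _ i∈ ; (y∈C , ρy) = T-∧⁻ {lookup C y} h in y , y∈C , ≡ᵇ⇒≡ (ρ y) _ ρy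

  rankSet⁺ : ∀ {C i y} → y ∈ₛ C → ρ y ≡ suc (toℕ i) → T (lookup (rankSet C) i)
  rankSet⁺ {C} {i} {y} y∈C ρy rewrite lookup∘tabulate (hasRank C) i =
    any-allFin⁺ _ y (T-∧⁺ y∈C (≡⇒≡ᵇ (ρ y) _ ρy))

  weight : Subset size → ℤ
  weight C = sign P ∣ rankSet C ∣

  chainTerm : Predᵇ → Subset size → ℤ
  chainTerm D C = ⟦ isChain P C ∧ C ⊑ D ⟧· weight C

  -- For D inside the interior ranks, χ D is minus the reduced Euler characteristic
  -- of the order complex of D: the empty chain counts +1 and a chain C counts (-1)^#C.
  χ : Predᵇ → ℤ
  χ D = ∑ (subsets size) (chainTerm D)

  _⊆ᵖ_ : Predᵇ → Predᵇ → Set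
  D ⊆ᵖ E = ∀ y → T (D y) → T (E y)

  ⊑-mono : ∀ {C D E} → (∀ y → y ∈ₛ C → T (D y) → T (E y)) → T (C ⊑ D) → T (C ⊑ E)
  ⊑-mono {C} {D} D⊆E C⊑D =
    all-allFin⁺ _ (λ y → T-⇒⁺ (λ y∈C → D⊆E y y∈C (T-⇒⁻ (all-allFin⁻ _ C⊑D y) y∈C)))

  chainTerm-cong : ∀ {C D E} → (∀ y → y ∈ₛ C → T (D y) → T (E y)) → (∀ y → y ∈ₛ C → T (E y) → T (D y)) →
                   chainTerm D C ≡ chainTerm E C
  chainTerm-cong {C} {D} {E} D⊆E E⊆D =
    cong (λ b → ⟦ isChain P C ∧ b ⟧· weight C) (T-⇔→≡ (⊑-mono {C} {D} {E} D⊆E) (⊑-mono {C} {E} {D} E⊆D))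

  χ-cong : ∀ {D E} → D ⊆ᵖ E → E ⊆ᵖ D → χ D ≡ χ E
  χ-cong {D} {E} D⊆E E⊆D =
    ∑-cong (subsets size) (λ C → chainTerm-cong {C} {D} {E} (λ y _ → D⊆E y) (λ y _ → E⊆D y))

  χ-∅ : χ (λ _ → false) ≡ 1ℤ
  χ-∅ = trans (∑-subsets-unique size _ ⊥ weight onlyEmpty ⊥-chain) weight-⊥
    where
    ∉⊥ : ∀ {y} → ¬ y ∈ₛ ⊥
    ∉⊥ {y} = subst T (lookup-replicate y false)
    ⊥-chain : T (isChain P ⊥ ∧ ⊥ ⊑ (λ _ → false))
    ⊥-chain = chainIn⁺ {⊥} (λ y y∈⊥ → ⊥-elim (∉⊥ y∈⊥)) (λ a _ a∈⊥ _ → ⊥-elim (∉⊥ a∈⊥))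
    onlyEmpty : ∀ C → T (isChain P C ∧ C ⊑ (λ _ → false)) → C ≡ ⊥
    onlyEmpty C h =
      Subset-ext (λ i → trans (T-false (proj₁ (chainIn⁻ {C} h) i)) (sym (lookup-replicate i false)))
    rankSet-⊥ : rankSet ⊥ ≡ ⊥
    rankSet-⊥ = Subset-ext (λ i → trans (T-false (λ i∈ → let (y , y∈⊥ , _) = rankSet⁻ {⊥} i∈ in ∉⊥ y∈⊥))
                                       (sym (lookup-replicate i false)))
    weight-⊥ : weight ⊥ ≡ 1ℤ
    weight-⊥ = cong (sign P) (trans (cong ∣_∣ rankSet-⊥) (∣⊥∣≡0 (rank ∸ 1)))

  _∖ₚ_ : Predᵇ → Fin size → Predᵇ
  (D ∖ₚ x) y = D y ∧ not ⌊ y ≟ x ⌋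

  comparable : Fin size → Predᵇ
  comparable x y = ((x ≼ y) ∨ (y ≼ x)) ∧ not ⌊ y ≟ x ⌋

  link : Predᵇ → Fin size → Predᵇ
  link D x y = D y ∧ comparable x y

  comparable⁻ : ∀ {x y} → T (comparable x y) → (x ≤ₚ y ⊎ y ≤ₚ x) × y ≢ x
  comparable⁻ {x} {y} h =
    let (x~y , y≢x) = T-∧⁻ {(x ≼ y) ∨ (y ≼ x)} h in T-∨⁻ {x ≼ y} x~y , toWitnessFalse y≢x

  comparable⁺ : ∀ {x y} → x ≤ₚ y ⊎ y ≤ₚ x → y ≢ x → T (comparable x y)
  comparable⁺ {x} {y} x~y y≢x = T-∧⁺ ([ T-∨⁺ˡ , T-∨⁺ʳ {x ≼ y} ]′ x~y) (fromWitnessFalse y≢x)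

  comparable-irrefl : ∀ x → ¬ T (comparable x x)
  comparable-irrefl x h = proj₂ (comparable⁻ h) refl

  comparable⇒ρ≢ : ∀ {x y} → T (comparable x y) → ρ y ≢ ρ x
  comparable⇒ρ≢ h ρy≡ρx with comparable⁻ h
  ... | inj₁ x≤y , y≢x = y≢x (sym (ρ-injective-≤ₚ x≤y (sym ρy≡ρx)))
  ... | inj₂ y≤x , y≢x = y≢x (ρ-injective-≤ₚ y≤x ρy≡ρx)

  antichain⇒¬comparable : ∀ {zs x y} → (∀ {a b} → a ∈ zs → b ∈ zs → a ≤ₚ b → a ≡ b) →
                          x ∈ zs → y ∈ zs → ¬ T (comparable x y)
  antichain⇒¬comparable antichain x∈ y∈ h with comparable⁻ h
  ... | inj₁ x≤y , y≢x = y≢x (sym (antichain x∈ y∈ x≤y))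
  ... | inj₂ y≤x , y≢x = y≢x (antichain y∈ x∈ y≤x)

  suc-toℕ-injective : ∀ {k} {i j : Fin k} → suc (toℕ i) ≡ suc (toℕ j) → i ≡ j
  suc-toℕ-injective = toℕ-injective ∘ suc-injective

  weight-insert : ∀ {C x} {j : Fin (rank ∸ 1)} → (∀ y → y ∈ₛ C → ρ y ≢ ρ x) → ρ x ≡ suc (toℕ j) →
                  weight (C [ x ]≔ true) ≡ - weight C
  weight-insert {C} {x} {j} ρ≢ρx ρx =
    cong (sign P) (trans (cong ∣_∣ rankSet-insert) (∣insert∣ (rankSet C) j j∉))
    where
    j∉ : lookup (rankSet C) j ≡ false
    j∉ = T-false (λ j∈ → let (y , y∈C , ρy) = rankSet⁻ {C} j∈ in ρ≢ρx y y∈C (trans ρy (sym ρx)))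
    to : ∀ i → T (lookup (rankSet (C [ x ]≔ true)) i) → T (lookup (rankSet C [ j ]≔ true) i)
    to i i∈ with rankSet⁻ {C [ x ]≔ true} i∈
    ... | y , y∈C′ , ρy with ∈-insert⁻ {C = C} y∈C′
    ... | inj₁ refl = subst (λ k → T (lookup (rankSet C [ j ]≔ true) k))
                            (suc-toℕ-injective (trans (sym ρx) ρy)) (∈-insert-self {C = rankSet C})
    ... | inj₂ y∈C  = ∈-insert⁺ {C = rankSet C} (rankSet⁺ {C} y∈C ρy)
    from : ∀ i → T (lookup (rankSet C [ j ]≔ true) i) → T (lookup (rankSet (C [ x ]≔ true)) i)
    from i i∈ with ∈-insert⁻ {C = rankSet C} i∈
    ... | inj₁ refl = rankSet⁺ {C [ x ]≔ true} {y = x} (∈-insert-self {C = C}) ρx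
    ... | inj₂ i∈C  =
      let (y , y∈C , ρy) = rankSet⁻ {C} i∈C in rankSet⁺ {C [ x ]≔ true} (∈-insert⁺ {C = C} y∈C) ρy
    rankSet-insert : rankSet (C [ x ]≔ true) ≡ rankSet C [ j ]≔ true
    rankSet-insert = Subset-ext (λ i → T-⇔→≡ (to i) (from i))

  insert-chainIn⇔ : ∀ {C D x} → T (D x) → ¬ x ∈ₛ C →
                    T (isChain P (C [ x ]≔ true) ∧ (C [ x ]≔ true) ⊑ D) ⇔ T (isChain P C ∧ C ⊑ link D x)
  insert-chainIn⇔ {C} {D} {x} Dx x∉C = mk⇔ to from
    where
    C′ : Subset size
    C′ = C [ x ]≔ true
    ∈C⇒≢x : ∀ {y} → y ∈ₛ C → y ≢ x
    ∈C⇒≢x y∈C refl = x∉C y∈C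
    to : T (isChain P C′ ∧ C′ ⊑ D) → T (isChain P C ∧ C ⊑ link D x)
    to h = let (C′⊆D , chain′) = chainIn⁻ {C′} h in chainIn⁺ {C}
      (λ y y∈C → T-∧⁺ (C′⊆D y (∈-insert⁺ {C = C} y∈C))
                      (T-∧⁺ (chain′ x y (∈-insert-self {C = C}) (∈-insert⁺ {C = C} y∈C))
                            (fromWitnessFalse (∈C⇒≢x y∈C))))
      (λ a b a∈C b∈C → chain′ a b (∈-insert⁺ {C = C} a∈C) (∈-insert⁺ {C = C} b∈C))
    from : T (isChain P C ∧ C ⊑ link D x) → T (isChain P C′ ∧ C′ ⊑ D)
    from h = chainIn⁺ {C′} C′⊆D chain′
      where
      C⊆link = proj₁ (chainIn⁻ {C} h)
      x~ : ∀ y → y ∈ₛ C → T ((x ≼ y) ∨ (y ≼ x))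
      x~ y y∈C = proj₁ (T-∧⁻ (proj₂ (T-∧⁻ {D y} (C⊆link y y∈C))))
      C′⊆D : ∀ y → y ∈ₛ C′ → T (D y)
      C′⊆D y y∈C′ with ∈-insert⁻ {C = C} y∈C′
      ... | inj₁ refl = Dx
      ... | inj₂ y∈C  = proj₁ (T-∧⁻ {D y} (C⊆link y y∈C))
      chain′ : IsChain C′
      chain′ a b a∈C′ b∈C′ with ∈-insert⁻ {C = C} a∈C′ | ∈-insert⁻ {C = C} b∈C′
      ... | inj₁ refl | inj₁ refl = T-∨⁺ˡ (≼-refl a)
      ... | inj₁ refl | inj₂ b∈C  = x~ b b∈C
      ... | inj₂ a∈C  | inj₁ refl = subst T (∨-comm (x ≼ a) (a ≼ x)) (x~ a a∈C)
      ... | inj₂ a∈C  | inj₂ b∈C  = proj₂ (chainIn⁻ {C} h) a b a∈C b∈C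

  chainTerm-∌ : ∀ {C E x} → x ∈ₛ C → ¬ T (E x) → chainTerm E C ≡ 0ℤ
  chainTerm-∌ {C} {E} {x} x∈C ¬Ex =
    cong (λ b → ⟦ b ⟧· weight C)
         (trans (cong (isChain P C ∧_) (T-false (λ C⊑E → ¬Ex (T-⇒⁻ (all-allFin⁻ _ C⊑E x) x∈C))))
                (∧-zeroʳ (isChain P C)))

  chainTerm-insert : ∀ {C D x} {j : Fin (rank ∸ 1)} → T (D x) → ρ x ≡ suc (toℕ j) → ¬ x ∈ₛ C →
                     chainTerm D (C [ x ]≔ true) ≡ - chainTerm (link D x) C
  chainTerm-insert {C} {D} {x} Dx ρx x∉C =
    ⟦⟧-neg (T-⇔→≡ (to chainIn⇔) (from chainIn⇔)) (λ h → weight-insert {C} {x} (ρ≢ρx h) ρx)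
    where
    open Equivalence
    chainIn⇔ = insert-chainIn⇔ {C} {D} {x} Dx x∉C
    ρ≢ρx : T (isChain P C ∧ C ⊑ link D x) → ∀ y → y ∈ₛ C → ρ y ≢ ρ x
    ρ≢ρx h y y∈C = comparable⇒ρ≢ (proj₂ (T-∧⁻ {D y} (proj₁ (chainIn⁻ {C} h) y y∈C)))

  χ-delete : ∀ {D x} {j : Fin (rank ∸ 1)} → T (D x) → ρ x ≡ suc (toℕ j) → χ D ≡ χ (D ∖ₚ x) - χ (link D x)
  χ-delete {D} {x} Dx ρx = begin
    χ D
      ≡⟨ ∑-subsets-pairing size x (chainTerm D) ⟩
    ∑[ C ∈ subsets size ] (if lookup C x then 0ℤ else chainTerm D C + chainTerm D (C [ x ]≔ true))
      ≡⟨ ∑-cong (subsets size) pairTerm ⟩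
    ∑[ C ∈ subsets size ] (chainTerm (D ∖ₚ x) C - chainTerm (link D x) C)
      ≡⟨ ∑-difference (subsets size) _ _ ⟩
    χ (D ∖ₚ x) - χ (link D x) ∎
    where
    open ≡-Reasoning
    pairTerm : ∀ C → (if lookup C x then 0ℤ else chainTerm D C + chainTerm D (C [ x ]≔ true)) ≡
                     chainTerm (D ∖ₚ x) C - chainTerm (link D x) C
    pairTerm C with lookup C x in x∈C
    ... | true  = sym (cong₂ _-_
      (chainTerm-∌ {C} {D ∖ₚ x} x∈C′ (λ h → toWitnessFalse (proj₂ (T-∧⁻ {D x} h)) refl))
      (chainTerm-∌ {C} {link D x} x∈C′ (λ h → comparable-irrefl x (proj₂ (T-∧⁻ {D x} h)))))
      where
      x∈C′ : x ∈ₛ C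
      x∈C′ = subst T (sym x∈C) tt
    ... | false = cong₂ _+_
      (chainTerm-cong {C} {D} {D ∖ₚ x}
        (λ y y∈C Dy → T-∧⁺ Dy (fromWitnessFalse (λ { refl → subst T x∈C y∈C })))
        (λ y _ h → proj₁ (T-∧⁻ {D y} h)))
      (chainTerm-insert {C} Dx ρx (subst T x∈C))

  χ-cone : ∀ {D a} {j : Fin (rank ∸ 1)} → T (D a) → ρ a ≡ suc (toℕ j) → (∀ y → T (D y) → y ≤ₚ a) → χ D ≡ 0ℤ
  χ-cone {D} {a} Da ρa ≤a = begin
    χ D                       ≡⟨ χ-delete Da ρa ⟩
    χ (D ∖ₚ a) - χ (link D a) ≡⟨ cong (_-_ (χ (D ∖ₚ a))) (χ-cong {link D a} {D ∖ₚ a} link⊆∖ ∖⊆link) ⟩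
    χ (D ∖ₚ a) - χ (D ∖ₚ a)   ≡⟨ +-inverseʳ (χ (D ∖ₚ a)) ⟩
    0ℤ                        ∎
    where
    open ≡-Reasoning
    link⊆∖ : link D a ⊆ᵖ (D ∖ₚ a)
    link⊆∖ y h = let (Dy , a~y) = T-∧⁻ {D y} h in T-∧⁺ Dy (proj₂ (T-∧⁻ {(a ≼ y) ∨ (y ≼ a)} a~y))
    ∖⊆link : (D ∖ₚ a) ⊆ᵖ link D a
    ∖⊆link y h = let (Dy , y≢a) = T-∧⁻ {D y} h in T-∧⁺ Dy (comparable⁺ (inj₂ (≤a y Dy)) (toWitnessFalse y≢a))

  χ-∖-head : ∀ (A : Predᵇ) {x xs} → x ∉ xs → ¬ T (A x) →
             χ ((λ y → A y ∨ ⌊ y ∈? x ∷ xs ⌋) ∖ₚ x) ≡ χ (λ y → A y ∨ ⌊ y ∈? xs ⌋)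
  χ-∖-head A {x} {xs} x∉xs ¬Ax = χ-cong {D ∖ₚ x} {D′} ∖⊆D′ D′⊆∖
    where
    D D′ : Predᵇ
    D  y = A y ∨ ⌊ y ∈? x ∷ xs ⌋
    D′ y = A y ∨ ⌊ y ∈? xs ⌋
    ∖⊆D′ : (D ∖ₚ x) ⊆ᵖ D′
    ∖⊆D′ y h with T-∧⁻ {D y} h
    ... | Dy , y≢x with T-∨⁻ {A y} Dy
    ... | inj₁ Ay = T-∨⁺ˡ Ay
    ... | inj₂ y∈ with toWitness {a? = y ∈? x ∷ xs} y∈
    ...   | here y≡x   = ⊥-elim (toWitnessFalse y≢x y≡x)
    ...   | there y∈xs = T-∨⁺ʳ {A y} (fromWitness y∈xs)
    D′⊆∖ : D′ ⊆ᵖ (D ∖ₚ x)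
    D′⊆∖ y h with T-∨⁻ {A y} h
    ... | inj₁ Ay = T-∧⁺ (T-∨⁺ˡ Ay) (fromWitnessFalse (λ { refl → ¬Ax Ay }))
    ... | inj₂ y∈ =
      let y∈xs = toWitness {a? = y ∈? xs} y∈ in
      T-∧⁺ (T-∨⁺ʳ {A y} (fromWitness (there y∈xs))) (fromWitnessFalse (λ { refl → x∉xs y∈xs }))

  χ-link-head : ∀ (A : Predᵇ) {x xs} → (∀ {y} → y ∈ x ∷ xs → ¬ T (comparable x y)) →
                χ (link (λ y → A y ∨ ⌊ y ∈? x ∷ xs ⌋) x) ≡ χ (λ y → A y ∧ comparable x y)
  χ-link-head A {x} {xs} incomparable =
    χ-cong {link D x} {λ y → A y ∧ comparable x y} link⊆ ⊆link
    where
    D : Predᵇ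
    D y = A y ∨ ⌊ y ∈? x ∷ xs ⌋
    link⊆ : link D x ⊆ᵖ (λ y → A y ∧ comparable x y)
    link⊆ y h with T-∧⁻ {D y} h
    ... | Dy , x~y with T-∨⁻ {A y} Dy
    ... | inj₁ Ay = T-∧⁺ Ay x~y
    ... | inj₂ y∈ = ⊥-elim (incomparable (toWitness {a? = y ∈? x ∷ xs} y∈) x~y)
    ⊆link : (λ y → A y ∧ comparable x y) ⊆ᵖ link D x
    ⊆link y h = let (Ay , x~y) = T-∧⁻ {A y} h in T-∧⁺ (T-∨⁺ˡ Ay) x~y

  χ-antichain : ∀ (A : Predᵇ) (xs : List (Fin size)) → Unique xs →
                (∀ {x} → x ∈ xs → ¬ T (A x)) →
                (∀ {x} → x ∈ xs → ∃[ j ] ρ x ≡ suc (toℕ {rank ∸ 1} j)) →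
                (∀ {a b} → a ∈ xs → b ∈ xs → a ≤ₚ b → a ≡ b) →
                χ (λ y → A y ∨ ⌊ y ∈? xs ⌋) ≡ χ A - ∑[ x ∈ xs ] χ (λ y → A y ∧ comparable x y)
  χ-antichain A [] _ _ _ _ = trans (χ-cong {_} {A} A∨⊥⊆A (λ _ → T-∨⁺ˡ)) (sym (+-identityʳ (χ A)))
    where
    A∨⊥⊆A : (λ y → A y ∨ false) ⊆ᵖ A
    A∨⊥⊆A y h with T-∨⁻ {A y} h
    ... | inj₁ Ay = Ay
  χ-antichain A (x ∷ xs) (x∉xs ∷ unique) ∉A interior antichain = begin
    χ D
      ≡⟨ χ-delete {D} (T-∨⁺ʳ {A x} (fromWitness (here refl))) (proj₂ (interior (here refl))) ⟩
    χ (D ∖ₚ x) - χ (link D x)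
      ≡⟨ cong₂ _-_ (χ-∖-head A (λ x∈xs → All.lookup x∉xs x∈xs refl) (∉A (here refl)))
                   (χ-link-head A (antichain⇒¬comparable antichain (here refl))) ⟩
    χ (λ y → A y ∨ ⌊ y ∈? xs ⌋) - χ (Aₓ x)
      ≡⟨ cong (_- χ (Aₓ x)) (χ-antichain A xs unique (∉A ∘ there) (interior ∘ there)
                                          (λ a∈ b∈ → antichain (there a∈) (there b∈))) ⟩
    χ A - ∑[ z ∈ xs ] χ (Aₓ z) - χ (Aₓ x)
      ≡⟨ regroup (χ A) (∑[ z ∈ xs ] χ (Aₓ z)) (χ (Aₓ x)) ⟩
    χ A - (χ (Aₓ x) + ∑[ z ∈ xs ] χ (Aₓ z)) ∎
    where
    open ≡-Reasoning
    D : Predᵇ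
    D y = A y ∨ ⌊ y ∈? x ∷ xs ⌋
    Aₓ : Fin size → Predᵇ
    Aₓ z y = A y ∧ comparable z y
    regroup : ∀ a b c → a - b - c ≡ a - (c + b)
    regroup = solve-∀

  -- The flag h-vector as a chain sum

  sign-∸ : ∀ {a b} → b ≤ a → sign P (a ∸ b) ≡ sign P a * sign P b
  sign-∸ {a} z≤n = sym (*-identityʳ (sign P a))
  sign-∸ {suc a} {suc b} (s≤s b≤a) = trans (sign-∸ b≤a) (neg-cancel (sign P a) (sign P b))
    where
    neg-cancel : ∀ x y → x * y ≡ - x * - y
    neg-cancel = solve-∀

  sumℤ≡∑ : ∀ xs → sumℤ P xs ≡ ∑[ z ∈ xs ] z
  sumℤ≡∑ []       = refl
  sumℤ≡∑ (z ∷ zs) = cong (_+_ z) (sumℤ≡∑ zs)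

  inRanks : RankSet P → Predᵇ
  inRanks S y = memRank P S (ρ y)

  memRank⁻ : ∀ {S r} → T (memRank P S r) → ∃[ i ] T (lookup S i) × suc (toℕ i) ≡ r
  memRank⁻ {S} {r} h =
    let (i , q) = any-allFin⁻ _ h ; (i∈S , e) = T-∧⁻ {lookup S i} q in i , i∈S , ≡ᵇ⇒≡ (suc (toℕ i)) r e

  memRank⁺ : ∀ {S i} → T (lookup S i) → T (memRank P S (suc (toℕ i)))
  memRank⁺ {S} {i} i∈S = any-allFin⁺ _ i (T-∧⁺ i∈S (≡⇒≡ᵇ (toℕ i) (toℕ i) refl))

  inRanks⁻ : ∀ {S y} → T (inRanks S y) → ∃[ i ] T (lookup S i) × ρ y ≡ suc (toℕ i)
  inRanks⁻ {S} h = let (i , i∈S , e) = memRank⁻ {S} h in i , i∈S , sym e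

  inRanks⁺ : ∀ {S y i} → T (lookup S i) → ρ y ≡ suc (toℕ i) → T (inRanks S y)
  inRanks⁺ {S} i∈S ρy = subst (λ r → T (memRank P S r)) (sym ρy) (memRank⁺ {S} i∈S)

  hasRankSet⁻ : ∀ {C U} → T (hasRankSet P C U) →
                (∀ y → y ∈ₛ C → T (inRanks U y)) × (∀ i → T (lookup U i) → T (lookup (rankSet C) i))
  hasRankSet⁻ {C} {U} h =
    let (ranks⊆U , U⊆ranks) = T-∧⁻ {all (λ x → not (lookup C x) ∨ inRanks U x) (allFin size)} h in
    (λ y → T-⇒⁻ (all-allFin⁻ _ ranks⊆U y)) ,
    (λ i i∈U → subst T (sym (lookup∘tabulate _ i)) (T-⇒⁻ (all-allFin⁻ _ U⊆ranks i) i∈U))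

  hasRankSet⁺ : ∀ {C U} → (∀ y → y ∈ₛ C → T (inRanks U y)) →
                (∀ i → T (lookup U i) → T (lookup (rankSet C) i)) → T (hasRankSet P C U)
  hasRankSet⁺ {C} {U} ranks⊆U U⊆ranks =
    T-∧⁺ (all-allFin⁺ _ (λ y → T-⇒⁺ (ranks⊆U y)))
         (all-allFin⁺ _ (λ i → T-⇒⁺ (λ i∈U → subst T (lookup∘tabulate _ i) (U⊆ranks i i∈U))))

  hasRankSet⇒≡rankSet : ∀ {C U} → T (hasRankSet P C U) → U ≡ rankSet C
  hasRankSet⇒≡rankSet {C} {U} h = Subset-ext (λ i → T-⇔→≡ (U⊆ranks i) (ranks⊆U i))
    where
    U⊆ranks : ∀ i → T (lookup U i) → T (lookup (rankSet C) i)
    U⊆ranks = proj₂ (hasRankSet⁻ {C} {U} h)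
    ranks⊆U : ∀ i → T (lookup (rankSet C) i) → T (lookup U i)
    ranks⊆U i i∈ranks =
      let (y , y∈C , ρy) = rankSet⁻ {C} i∈ranks
          (i′ , i′∈U , ρy′) = inRanks⁻ {U} (proj₁ (hasRankSet⁻ {C} {U} h) y y∈C)
      in subst (λ k → T (lookup U k)) (suc-toℕ-injective (trans (sym ρy′) ρy)) i′∈U

  hasRankSet⇒⊑ : ∀ {C U S} → T (U ⊆ᵇ S) → T (hasRankSet P C U) → T (C ⊑ inRanks S)
  hasRankSet⇒⊑ {C} {U} {S} U⊆S h = all-allFin⁺ _ (λ y → T-⇒⁺ (λ y∈C →
    let (i , i∈U , ρy) = inRanks⁻ {U} (proj₁ (hasRankSet⁻ {C} {U} h) y y∈C) in
    inRanks⁺ {S} (⊆ᵇ⁻ {U = U} {S} U⊆S i i∈U) ρy))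

  ⊑⇒hasRankSet : ∀ {C S} → T (C ⊑ inRanks S) → T (rankSet C ⊆ᵇ S ∧ hasRankSet P C (rankSet C))
  ⊑⇒hasRankSet {C} {S} C⊑S =
    T-∧⁺ (⊆ᵇ⁺ {U = rankSet C} {S} ranks⊆S) (hasRankSet⁺ {C} {rankSet C} ranks-in (λ _ i∈ → i∈))
    where
    inS : ∀ y → y ∈ₛ C → ∃[ i ] T (lookup S i) × ρ y ≡ suc (toℕ i)
    inS y y∈C = inRanks⁻ {S} (T-⇒⁻ (all-allFin⁻ _ C⊑S y) y∈C)
    ranks⊆S : ∀ i → T (lookup (rankSet C) i) → T (lookup S i)
    ranks⊆S i i∈ranks =
      let (y , y∈C , ρy) = rankSet⁻ {C} i∈ranks ; (i′ , i′∈S , ρy′) = inS y y∈C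
      in subst (λ k → T (lookup S k)) (suc-toℕ-injective (trans (sym ρy′) ρy)) i′∈S
    ranks-in : ∀ y → y ∈ₛ C → T (inRanks (rankSet C) y)
    ranks-in y y∈C = let (i , _ , ρy) = inS y y∈C in inRanks⁺ {rankSet C} (rankSet⁺ {C} y∈C ρy) ρy

  ∑-rankSets : ∀ S C →
               ∑[ U ∈ subsets (rank ∸ 1) ] ⟦ isChain P C ∧ (U ⊆ᵇ S ∧ hasRankSet P C U) ⟧· sign P (∣ S ∣ ∸ ∣ U ∣)
               ≡ sign P ∣ S ∣ * ⟦ isChain P C ∧ C ⊑ inRanks S ⟧· weight C
  ∑-rankSets S C with isChain P C
  ... | false = trans (∑-zero (subsets (rank ∸ 1)) (λ _ → refl)) (sym (*-zeroʳ (sign P ∣ S ∣)))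
  ... | true with C ⊑ inRanks S in C⊑S
  ...   | true  = trans (∑-subsets-unique (rank ∸ 1) _ (rankSet C) _ onlyRankSet withinS)
                        (sign-∸ (∣∣-mono-⊆ᵇ (rankSet C) S (proj₁ (T-∧⁻ {rankSet C ⊆ᵇ S} withinS))))
    where
    withinS : T (rankSet C ⊆ᵇ S ∧ hasRankSet P C (rankSet C))
    withinS = ⊑⇒hasRankSet {C} {S} (subst T (sym C⊑S) tt)
    onlyRankSet : ∀ U → T (U ⊆ᵇ S ∧ hasRankSet P C U) → U ≡ rankSet C
    onlyRankSet U h = hasRankSet⇒≡rankSet {C} {U} (proj₂ (T-∧⁻ {U ⊆ᵇ S} h))
  ...   | false = trans (∑-zero (subsets (rank ∸ 1)) vanish) (sym (*-zeroʳ (sign P ∣ S ∣)))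
    where
    vanish : ∀ U → ⟦ U ⊆ᵇ S ∧ hasRankSet P C U ⟧· sign P (∣ S ∣ ∸ ∣ U ∣) ≡ 0ℤ
    vanish U = cong (λ b → ⟦ b ⟧· sign P (∣ S ∣ ∸ ∣ U ∣)) (T-false (λ h →
      let (U⊆S , has) = T-∧⁻ {U ⊆ᵇ S} h in subst T C⊑S (hasRankSet⇒⊑ {C} {U} {S} U⊆S has)))

  flagH≡sign*χ : ∀ S → flagH P S ≡ sign P ∣ S ∣ * χ (inRanks S)
  flagH≡sign*χ S = begin
    flagH P S
      ≡⟨ trans (sumℤ≡∑ (map F (filterᵇ (_⊆ᵇ S) Us))) (∑-map (filterᵇ (_⊆ᵇ S) Us) F (λ z → z)) ⟩
    ∑ (filterᵇ (_⊆ᵇ S) Us) F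
      ≡⟨ ∑-filterᵇ (_⊆ᵇ S) Us F ⟩
    ∑[ U ∈ Us ] ⟦ U ⊆ᵇ S ⟧· F U
      ≡⟨ ∑-cong Us (λ U → trans (⟦⟧·-length-filterᵇ (U ⊆ᵇ S) (sg U) _ Cs)
                                (∑-cong Cs (λ C → cong (λ b → ⟦ b ⟧· sg U) (∧-swap (U ⊆ᵇ S) (isChain P C) _)))) ⟩
    ∑[ U ∈ Us ] ∑[ C ∈ Cs ] term U C
      ≡⟨ ∑-comm Us Cs term ⟩
    ∑[ C ∈ Cs ] ∑[ U ∈ Us ] term U C
      ≡⟨ ∑-cong Cs (∑-rankSets S) ⟩
    ∑[ C ∈ Cs ] (sign P ∣ S ∣ * chainTerm (inRanks S) C)
      ≡⟨ sym (*-distribˡ-∑ Cs (sign P ∣ S ∣) _) ⟩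
    sign P ∣ S ∣ * χ (inRanks S) ∎
    where
    open ≡-Reasoning
    Us : List (RankSet P)
    Us = subsets (rank ∸ 1)
    Cs : List (Subset size)
    Cs = subsets size
    sg : RankSet P → ℤ
    sg U = sign P (∣ S ∣ ∸ ∣ U ∣)
    F : RankSet P → ℤ
    F U = sg U * + flagF P U
    term : RankSet P → Subset size → ℤ
    term U C = ⟦ isChain P C ∧ (U ⊆ᵇ S ∧ hasRankSet P C U) ⟧· sg U
    ∧-swap : ∀ a b c → a ∧ (b ∧ c) ≡ b ∧ (a ∧ c)
    ∧-swap true  b c = refl
    ∧-swap false b c = sym (∧-zeroʳ b)

  -- (a) ⇒ (b)

  level : ℕ → List (Fin size)
  level r = filterᵇ (λ x → ρ x ≡ᵇ r) (allFin size)

  level-unique : ∀ r → Unique (level r)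
  level-unique r = filter⁺ (T? ∘ λ x → ρ x ≡ᵇ r) (allFin⁺ size)

  ∈-level⁺ : ∀ {x r} → ρ x ≡ r → x ∈ level r
  ∈-level⁺ {x} {r} ρx = ∈-filter⁺ (T? ∘ λ x → ρ x ≡ᵇ r) (∈-allFin x) (≡⇒≡ᵇ (ρ x) r ρx)

  ∈-level⁻ : ∀ {x r} → x ∈ level r → ρ x ≡ r
  ∈-level⁻ {x} {r} x∈ = ≡ᵇ⇒≡ (ρ x) r (proj₂ (∈-filter⁻ (T? ∘ λ x → ρ x ≡ᵇ r) {xs = allFin size} x∈))

  level-antichain : ∀ {r a b} → a ∈ level r → b ∈ level r → a ≤ₚ b → a ≡ b
  level-antichain a∈ b∈ a≤b = ρ-injective-≤ₚ a≤b (trans (∈-level⁻ a∈) (sym (∈-level⁻ b∈)))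

  χ-singleRank : ∀ j → χ (inRanks ⁅ j ⁆) ≡ 1ℤ - + rankCount P (suc (toℕ j))
  χ-singleRank j = begin
    χ (inRanks ⁅ j ⁆)
      ≡⟨ χ-cong {inRanks ⁅ j ⁆} {λ y → ⌊ y ∈? level r ⌋} to from ⟩
    χ (λ y → ⌊ y ∈? level r ⌋)
      ≡⟨ χ-antichain (λ _ → false) (level r) (level-unique r) (λ _ ()) (λ x∈ → j , ∈-level⁻ x∈) level-antichain ⟩
    χ (λ _ → false) - ∑[ x ∈ level r ] χ (λ _ → false)
      ≡⟨ cong₂ _-_ χ-∅ (trans (∑-cong (level r) (λ _ → χ-∅)) (∑-1≡length (level r))) ⟩
    1ℤ - + length (level r) ∎
    where
    open ≡-Reasoning
    r : ℕ
    r = suc (toℕ j)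
    to : inRanks ⁅ j ⁆ ⊆ᵖ (λ y → ⌊ y ∈? level r ⌋)
    to y h = let (i , i∈ , ρy) = inRanks⁻ {⁅ j ⁆} h in
      fromWitness (∈-level⁺ (subst (λ k → ρ y ≡ suc (toℕ k)) (⁅⁆⁻ i∈) ρy))
    from : (λ y → ⌊ y ∈? level r ⌋) ⊆ᵖ inRanks ⁅ j ⁆
    from y h = inRanks⁺ {⁅ j ⁆} (⁅⁆-self j) (∈-level⁻ (toWitness {a? = y ∈? level r} h))

  rank-cases : ∀ r → r ≡ 0 ⊎ rank ≤ r ⊎ ∃[ j ] r ≡ suc (toℕ {rank ∸ 1} j)
  rank-cases zero = inj₁ refl
  rank-cases (suc k) with rank ≤? suc k
  ... | yes rank≤r = inj₂ (inj₁ rank≤r)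
  ... | no  rank≰r = inj₂ (inj₂ (fromℕ< k<m , cong suc (sym (toℕ-fromℕ< k<m))))
    where
    k<m : k < rank ∸ 1
    k<m = ∸-monoˡ-≤ 1 (≰⇒> rank≰r)

  rankCount≤1 : ∀ {r z} → (∀ x → ρ x ≡ r → x ≡ z) → rankCount P r ≤ 1
  rankCount≤1 {r} only-z = Unique-constant⇒length≤1 (level-unique r) (λ x∈ → only-z _ (∈-level⁻ x∈))

  multiplicityFree⇒atMostTwo : MultiplicityFree P → AtMostTwoPerRank P
  multiplicityFree⇒atMostTwo mf r with rank-cases r
  ... | inj₁ refl          = ≤-trans (rankCount≤1 (λ _ → ρ≡0⇒≡bot)) (n≤1+n 1)
  ... | inj₂ (inj₁ rank≤r) =
    ≤-trans (rankCount≤1 (λ _ ρx → rank≤ρ⇒≡top (subst (rank ≤_) (sym ρx) rank≤r))) (n≤1+n 1)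
  ... | inj₂ (inj₂ (j , refl)) = ZeroOrUnit-1-n⇒n≤2 _ (subst ZeroOrUnit flagH-single (mf ⁅ j ⁆))
    where
    flagH-single : flagH P ⁅ j ⁆ ≡ - (1ℤ - + rankCount P (suc (toℕ j)))
    flagH-single = begin
      flagH P ⁅ j ⁆                          ≡⟨ flagH≡sign*χ ⁅ j ⁆ ⟩
      sign P ∣ ⁅ j ⁆ ∣ * χ (inRanks ⁅ j ⁆)   ≡⟨ cong (λ k → sign P k * χ (inRanks ⁅ j ⁆)) (∣⁅x⁆∣≡1 j) ⟩
      -1ℤ * χ (inRanks ⁅ j ⁆)                ≡⟨ -1*i≡-i _ ⟩
      - χ (inRanks ⁅ j ⁆)                    ≡⟨ cong -_ (χ-singleRank j) ⟩
      - (1ℤ - + rankCount P (suc (toℕ j)))   ∎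
      where open ≡-Reasoning

  -- (b) ⇒ (a)

  sign-ZeroOrUnit : ∀ k → ZeroOrUnit (sign P k)
  sign-ZeroOrUnit zero    = inj₂ (inj₁ refl)
  sign-ZeroOrUnit (suc k) =
    subst ZeroOrUnit (-1*i≡-i (sign P k)) (ZeroOrUnit-* (inj₂ (inj₂ refl)) (sign-ZeroOrUnit k))

  no-three-of-a-rank : AtMostTwoPerRank P → ∀ {r a b c} → ρ a ≡ r → ρ b ≡ r → ρ c ≡ r →
                       a ≡ b ⊎ a ≡ c ⊎ b ≡ c
  no-three-of-a-rank two {r} ρa ρb ρc =
    pigeonhole-length≤2 (two r) (∈-level⁺ ρa) (∈-level⁺ ρb) (∈-level⁺ ρc)

  module _ (two : AtMostTwoPerRank P) (S : RankSet P) where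

    below : ℕ → Predᵇ
    below r y = inRanks S y ∧ (ρ y <ᵇ r)

    below⁻ : ∀ {r y} → T (below r y) → T (inRanks S y) × ρ y < r
    below⁻ {r} {y} h = let (y∈S , ρy<r) = T-∧⁻ {inRanks S y} h in y∈S , <ᵇ⇒< (ρ y) r ρy<r

    below⁺ : ∀ {r y} → T (inRanks S y) → ρ y < r → T (below r y)
    below⁺ y∈S ρy<r = T-∧⁺ y∈S (<⇒<ᵇ ρy<r)

    inRanks⇒<rank : ∀ {y} → T (inRanks S y) → ρ y < rank
    inRanks⇒<rank {y} y∈S =
      let (i , _ , ρy) = inRanks⁻ {S} y∈S in subst (_< rank) (sym ρy) (<∸1⇒suc< rank (toℕ<n i))

    χ-link-below-all : ∀ {r x} → ρ x ≡ r → (∀ y → T (below r y) → y ≤ₚ x) →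
                       χ (λ y → below r y ∧ comparable x y) ≡ χ (below r)
    χ-link-below-all {r} {x} ρx all≤x = χ-cong {λ y → below r y ∧ comparable x y} {below r}
      (λ y h → proj₁ (T-∧⁻ {below r y} h))
      (λ y By → T-∧⁺ By (comparable⁺ (inj₂ (all≤x y By)) (λ { refl → <-irrefl ρx (proj₂ (below⁻ {r} By)) })))

    -- Among three elements of rank r′ two coincide; this makes the element a of rank r′
    -- below x an upper bound of the link of x within below r.
    link≤apex : ∀ {r x y a r′} → ρ x ≡ r → T (below r y) → ¬ y ≤ₚ x → ρ a ≡ r′ → a ≤ₚ x → r′ < r →
           (∀ {k} → k < r → T (memRank P S k) → k ≤ r′) →
           ∀ z → T (below r z ∧ comparable x z) → z ≤ₚ a
    link≤apex {r} {x} {y} {a} {r′} ρx By y≰x ρa a≤x r′<r greatest z h =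
      let (z′ , ρz′ , z≤z′ , z′≤x) = intermediate z≤x (greatest ρz<r z∈S) r′≤ρx
          (y′ , ρy′ , y≤y′ , _)    = intermediate (top-max y) (greatest ρy<r y∈S) r′≤ρtop
      in three-way ρz′ z≤z′ z′≤x ρy′ y≤y′
      where
      Bz : T (below r z)
      Bz = proj₁ (T-∧⁻ {below r z} h)
      z∈S = proj₁ (below⁻ {r} Bz)
      ρz<r = proj₂ (below⁻ {r} Bz)
      y∈S = proj₁ (below⁻ {r} By)
      ρy<r = proj₂ (below⁻ {r} By)
      r′≤ρx : r′ ≤ ρ x
      r′≤ρx = subst (r′ ≤_) (sym ρx) (<⇒≤ r′<r)
      r′≤ρtop : r′ ≤ ρ top
      r′≤ρtop = ≤-trans r′≤ρx (ρ-mono (top-max x))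
      z≤x : z ≤ₚ x
      z≤x with comparable⁻ (proj₂ (T-∧⁻ {below r z} h))
      ... | inj₁ x≤z , _ = ⊥-elim (<⇒≱ ρz<r (subst (_≤ ρ z) ρx (ρ-mono x≤z)))
      ... | inj₂ z≤x , _ = z≤x
      three-way : ∀ {z′ y′} → ρ z′ ≡ r′ → z ≤ₚ z′ → z′ ≤ₚ x → ρ y′ ≡ r′ → y ≤ₚ y′ → z ≤ₚ a
      three-way ρz′ z≤z′ z′≤x ρy′ y≤y′ with no-three-of-a-rank two ρa ρz′ ρy′
      ... | inj₁ refl        = z≤z′
      ... | inj₂ (inj₁ refl) = ⊥-elim (y≰x (≼-trans y a x y≤y′ a≤x))
      ... | inj₂ (inj₂ refl) = ⊥-elim (y≰x (≼-trans y _ x y≤y′ z′≤x))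

    χ-link-below : ∀ {r x} → ρ x ≡ r →
                   χ (λ y → below r y ∧ comparable x y) ≡ χ (below r) ⊎ χ (λ y → below r y ∧ comparable x y) ≡ 0ℤ
    χ-link-below {r} {x} ρx with any? (λ y → T? (below r y) ×-dec ¬? (T? (y ≼ x)))
    ... | no ∄y =
      inj₁ (χ-link-below-all ρx (λ y By → decidable-stable (T? (y ≼ x)) (λ y≰x → ∄y (y , By , y≰x))))
    ... | yes (y , By , y≰x) =
      let (y∈S , ρy<r) = below⁻ {r} By
          (r′ , r′<r , r′∈S , greatest) = greatest-below (memRank P S) ρy<r y∈S
          (a , ρa , _ , a≤x) = intermediate (bot-min x) (subst (_≤ r′) (sym ρ-bot) z≤n)
                                            (subst (r′ ≤_) (sym ρx) (<⇒≤ r′<r))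
          a∈S = subst (λ k → T (memRank P S k)) (sym ρa) r′∈S
          a≢x : a ≢ x
          a≢x = λ a≡x → <-irrefl (trans (sym ρa) (trans (cong ρ a≡x) ρx)) r′<r
          Da = T-∧⁺ (below⁺ {r} a∈S (subst (_< r) (sym ρa) r′<r))
                    (comparable⁺ (inj₂ a≤x) a≢x)
      in inj₂ (χ-cone {λ y → below r y ∧ comparable x y} Da (proj₂ (proj₂ (inRanks⁻ {S} a∈S)))
                      (link≤apex ρx By y≰x ρa a≤x r′<r greatest))

    levelInS : ℕ → List (Fin size)
    levelInS r = filterᵇ (inRanks S) (level r)

    ∈-levelInS⁻ : ∀ {x r} → x ∈ levelInS r → T (inRanks S x) × ρ x ≡ r
    ∈-levelInS⁻ {x} {r} x∈ =
      let (x∈level , x∈S) = ∈-filter⁻ (T? ∘ inRanks S) {xs = level r} x∈ in x∈S , ∈-level⁻ x∈level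

    ∈-levelInS⁺ : ∀ {x r} → T (inRanks S x) → ρ x ≡ r → x ∈ levelInS r
    ∈-levelInS⁺ x∈S ρx = ∈-filter⁺ (T? ∘ inRanks S) (∈-level⁺ ρx) x∈S

    χ-below-suc : ∀ r →
                  χ (below (suc r)) ≡ χ (below r) - ∑[ x ∈ levelInS r ] χ (λ y → below r y ∧ comparable x y)
    χ-below-suc r = trans (χ-cong {below (suc r)} {λ y → below r y ∨ ⌊ y ∈? levelInS r ⌋} split merge)
                          (χ-antichain (below r) (levelInS r) (filter⁺ (T? ∘ inRanks S) (level-unique r))
                                       not-below interior antichain)
      where
      not-below : ∀ {x} → x ∈ levelInS r → ¬ T (below r x)
      not-below x∈ Bx = <-irrefl (proj₂ (∈-levelInS⁻ x∈)) (proj₂ (below⁻ {r} Bx))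
      interior : ∀ {x} → x ∈ levelInS r → ∃[ j ] ρ x ≡ suc (toℕ j)
      interior x∈ = let (j , _ , ρx) = inRanks⁻ {S} (proj₁ (∈-levelInS⁻ x∈)) in j , ρx
      antichain : ∀ {a b} → a ∈ levelInS r → b ∈ levelInS r → a ≤ₚ b → a ≡ b
      antichain a∈ b∈ a≤b =
        ρ-injective-≤ₚ a≤b (trans (proj₂ (∈-levelInS⁻ a∈)) (sym (proj₂ (∈-levelInS⁻ b∈))))
      split : below (suc r) ⊆ᵖ (λ y → below r y ∨ ⌊ y ∈? levelInS r ⌋)
      split y h with below⁻ {suc r} h | ρ y ≟ℕ r
      ... | y∈S , _     | yes ρy≡r = T-∨⁺ʳ {below r y} (fromWitness (∈-levelInS⁺ y∈S ρy≡r))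
      ... | y∈S , ρy<1+r | no ρy≢r = T-∨⁺ˡ (below⁺ {r} y∈S (≤∧≢⇒< (≤-pred ρy<1+r) ρy≢r))
      merge : (λ y → below r y ∨ ⌊ y ∈? levelInS r ⌋) ⊆ᵖ below (suc r)
      merge y h with T-∨⁻ {below r y} h
      ... | inj₁ By = let (y∈S , ρy<r) = below⁻ {r} By in below⁺ {suc r} y∈S (m≤n⇒m≤1+n ρy<r)
      ... | inj₂ y∈ = let (y∈S , ρy≡r) = ∈-levelInS⁻ (toWitness {a? = y ∈? levelInS r} y∈) in
                      below⁺ {suc r} y∈S (subst (_< suc r) (sym ρy≡r) (n<1+n r))

    χ-below-ZeroOrUnit : ∀ r → ZeroOrUnit (χ (below r))
    χ-below-ZeroOrUnit zero = inj₂ (inj₁ (trans (χ-cong {below 0} {λ _ → false} below0⊆∅ (λ _ ())) χ-∅))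
      where
      below0⊆∅ : below 0 ⊆ᵖ (λ _ → false)
      below0⊆∅ y h = ⊥-elim (n≮0 (proj₂ (below⁻ {0} h)))
    χ-below-ZeroOrUnit (suc r) =
      let (k , k≤length , ∑≡k*χ) = ∑-choices _ (levelInS r) (λ x∈ → χ-link-below (proj₂ (∈-levelInS⁻ x∈)))
          k≤2 = ≤-trans k≤length (≤-trans (length-filter (T? ∘ inRanks S) (level r)) (two r))
          χ-step : χ (below (suc r)) ≡ (1ℤ - + k) * χ (below r)
          χ-step = trans (χ-below-suc r) (trans (cong (_-_ (χ (below r))) ∑≡k*χ) (factor (χ (below r)) (+ k)))
      in subst ZeroOrUnit (sym χ-step) (ZeroOrUnit-* (ZeroOrUnit-1-k k k≤2) (χ-below-ZeroOrUnit r))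
      where
      factor : ∀ s k → s - k * s ≡ (1ℤ - k) * s
      factor = solve-∀

    flagH-ZeroOrUnit : ZeroOrUnit (flagH P S)
    flagH-ZeroOrUnit = subst ZeroOrUnit (sym (flagH≡sign*χ S))
      (ZeroOrUnit-* (sign-ZeroOrUnit ∣ S ∣) (subst ZeroOrUnit χ-below-rank (χ-below-ZeroOrUnit rank)))
      where
      χ-below-rank : χ (below rank) ≡ χ (inRanks S)
      χ-below-rank = χ-cong {below rank} {inRanks S} (λ y h → proj₁ (below⁻ {rank} h))
                                                     (λ y y∈S → below⁺ {rank} y∈S (inRanks⇒<rank y∈S))

theorem4p1 : (P : GradedPoset) → MultiplicityFree P ⇔ AtMostTwoPerRank P
theorem4p1 P = mk⇔ (multiplicityFree⇒atMostTwo P) (λ two S → flagH-ZeroOrUnit P two S)
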